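{- Let $m$ be a positive integer and $u,w\in[m]^*$ with $uw\equiv wu$. Then $\mathrm{RC}_m(w)\,\mathrm{RC}_m(u)\equiv\mathrm{RC}_m(u)\,\mathrm{RC}_m(w)$, and $\epsilon_m(P(w))=P(v)$ for some word $v$ with $v\,\mathrm{RC}_m(u)\equiv\mathrm{RC}_m(u)\,v$.
   Context: Words are finite strings of positive integers; $[m]^*$ is the set of words with letters in $\{1,\dots,m\}$. $P(w)$ is the RSK insertion tableau of $w$. Knuth equivalence $\equiv$ is generated by $xacby\equiv xcaby$ for $a\le b<c$ and $xbacy\equiv xbcay$ for $a<b\le c$; $v\equiv w$ iff $P(v)=P(w)$. For $w=w_1\cdots w_n\in[m]^*$, $\mathrm{RC}_m(w)=(m+1-w_n)\cdots(m+1-w_1)$. For a semistandard tableau $T$, $\mathrm{rw}(T)$ is its row word, read left to right along each row starting from the bottom row and moving up. For a tableau $T$ with entries in $[m]$, $\epsilon_m(T)=P(\mathrm{RC}_m(\mathrm{rw}(T)))$. -}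

module Defs where

open import Data.Nat using (ℕ; zero; suc; _≤_; _<_; _∸_; _≤ᵇ_)
open import Data.Bool using (Bool; true; false; if_then_else_)
open import Data.List using (List; []; _∷_; _++_; reverse; map; foldl; concat)
open import Data.List.Relation.Unary.All using (All)
open import Data.Product using (_×_)

Word : Set
Word = List ℕ

InAlphabet : ℕ → Word → Set
InAlphabet m w = All (λ x → 1 ≤ x × x ≤ m) w

-- Tableaux: list of rows, top row (row 1) first; each row weakly increasing.
Tableau : Set
Tableau = List (List ℕ)

data Bump : Set where
  none : Bump
  some : ℕ → Bump

rowInsert : ℕ → List ℕ → Bump × List ℕ
rowInsert x [] = none Data.Product., (x ∷ [])
rowInsert x (y ∷ ys) with y Data.Nat.≤ᵇ x
... | true  with rowInsert x ys
...   | b Data.Product., ys' = b Data.Product., (y ∷ ys')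
rowInsert x (y ∷ ys) | false = some y Data.Product., (x ∷ ys)

insert : Tableau → ℕ → Tableau
insert [] x = (x ∷ []) ∷ []
insert (r ∷ rs) x with rowInsert x r
... | none   Data.Product., r' = r' ∷ rs
... | some y Data.Product., r' = r' ∷ insert rs y

P : Word → Tableau
P w = foldl insert [] w

rw : Tableau → Word
rw T = concat (reverse T)

RC : ℕ → Word → Word
RC m w = reverse (map (λ x → suc m ∸ x) w)

data _≡K_ : Word → Word → Set where
  knuth₁ : ∀ x y {a b c} → a ≤ b → b < c →
           (x ++ a ∷ c ∷ b ∷ y) ≡K (x ++ c ∷ a ∷ b ∷ y)
  knuth₂ : ∀ x y {a b c} → a < b → b ≤ c →
           (x ++ b ∷ a ∷ c ∷ y) ≡K (x ++ b ∷ c ∷ a ∷ y)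
  K-refl  : ∀ {v} → v ≡K v
  K-sym   : ∀ {v w} → v ≡K w → w ≡K v
  K-trans : ∀ {u v w} → u ≡K v → v ≡K w → u ≡K w

infix 4 _≡K_

ε : ℕ → Tableau → Tableau
ε m T = P (RC m (rw T))

-- RC m reverses a word and complements its letters; on [m]* this swaps the two
-- elementary Knuth relations, so RC m respects ≡K and the commutation u w ≡K w u
-- becomes RC w RC u ≡K RC u RC w.  For the second claim take v = RC m (rw (P w)),
-- so that ε m (P w) = P v holds by definition.  Schensted insertion changes the row
-- word only by Knuth moves, i.e. rw (P w) ≡K w, hence v ≡K RC m w, and v inherits
-- the commutation with RC m u.
module Submission where

open import Defs
open import Data.Nat using (ℕ; _≤_; _<_; suc; _∸_; _≤ᵇ_)
open import Data.Nat.Properties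
  using (≤-trans; ≤-refl; <-≤-trans; ≤-<-trans; <⇒≤; ∸-monoʳ-≤; ∸-monoʳ-<; ≤ᵇ⇒≤; ≤⇒≤ᵇ; ≰⇒>; m≤n⇒m≤1+n)
open import Data.Bool using (true; false; T)
open import Data.List using (List; []; _∷_; _++_; reverse; map; foldl; concat; [_])
open import Data.List.Properties using (++-assoc; map-++; reverse-++; concat-++; unfold-reverse; ++-identityʳ)
open import Data.List.Relation.Unary.All using (All; []; _∷_)
import Data.List.Relation.Unary.All as All
open import Data.List.Relation.Unary.All.Properties using (++⁺; ++⁻ˡ; ++⁻ʳ)
open import Data.List.Relation.Unary.AllPairs using (AllPairs; []; _∷_)
open import Data.Product using (_×_; ∃-syntax; _,_; proj₂)
open import Relation.Binary.Bundles using (Setoid)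
open import Relation.Binary.PropositionalEquality using (_≡_; refl; sym; trans; cong; subst; subst₂)
import Relation.Binary.Reasoning.Setoid as SetoidReasoning

≡⇒≡K : ∀ {v w} → v ≡ w → v ≡K w
≡⇒≡K refl = K-refl

≡K-setoid : Setoid _ _
≡K-setoid = record
  { Carrier       = Word
  ; _≈_           = _≡K_
  ; isEquivalence = record { refl = K-refl ; sym = K-sym ; trans = K-trans }
  }

module ≡K-Reasoning = SetoidReasoning ≡K-setoid

≡K-++⁺ˡ : ∀ pre {v w} → v ≡K w → (pre ++ v) ≡K (pre ++ w)
≡K-++⁺ˡ pre (knuth₁ x y p q) =
  subst₂ _≡K_ (++-assoc pre x _) (++-assoc pre x _) (knuth₁ (pre ++ x) y p q)
≡K-++⁺ˡ pre (knuth₂ x y p q) =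
  subst₂ _≡K_ (++-assoc pre x _) (++-assoc pre x _) (knuth₂ (pre ++ x) y p q)
≡K-++⁺ˡ pre K-refl        = K-refl
≡K-++⁺ˡ pre (K-sym e)     = K-sym (≡K-++⁺ˡ pre e)
≡K-++⁺ˡ pre (K-trans e f) = K-trans (≡K-++⁺ˡ pre e) (≡K-++⁺ˡ pre f)

≡K-++⁺ʳ : ∀ suf {v w} → v ≡K w → (v ++ suf) ≡K (w ++ suf)
≡K-++⁺ʳ suf (knuth₁ x y {a} {b} {c} p q) =
  subst₂ _≡K_ (sym (++-assoc x (a ∷ c ∷ b ∷ y) suf)) (sym (++-assoc x (c ∷ a ∷ b ∷ y) suf))
    (knuth₁ x (y ++ suf) p q)
≡K-++⁺ʳ suf (knuth₂ x y {a} {b} {c} p q) =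
  subst₂ _≡K_ (sym (++-assoc x (b ∷ a ∷ c ∷ y) suf)) (sym (++-assoc x (b ∷ c ∷ a ∷ y) suf))
    (knuth₂ x (y ++ suf) p q)
≡K-++⁺ʳ suf K-refl        = K-refl
≡K-++⁺ʳ suf (K-sym e)     = K-sym (≡K-++⁺ʳ suf e)
≡K-++⁺ʳ suf (K-trans e f) = K-trans (≡K-++⁺ʳ suf e) (≡K-++⁺ʳ suf f)

module _ {Q : ℕ → Set} where

  All-swap₁₂ : ∀ x y {a b c} → All Q (x ++ a ∷ b ∷ c ∷ y) → All Q (x ++ b ∷ a ∷ c ∷ y)
  All-swap₁₂ x y p with ++⁻ʳ x p
  ... | qa ∷ qb ∷ qc ∷ qy = ++⁺ (++⁻ˡ x p) (qb ∷ qa ∷ qc ∷ qy)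

  All-swap₂₃ : ∀ x y {a b c} → All Q (x ++ a ∷ b ∷ c ∷ y) → All Q (x ++ a ∷ c ∷ b ∷ y)
  All-swap₂₃ x y p with ++⁻ʳ x p
  ... | qa ∷ qb ∷ qc ∷ qy = ++⁺ (++⁻ˡ x p) (qa ∷ qc ∷ qb ∷ qy)

  All-resp-≡K   : ∀ {v w} → v ≡K w → All Q v → All Q w
  All-resp-≡K⁻¹ : ∀ {v w} → v ≡K w → All Q w → All Q v

  All-resp-≡K (knuth₁ x y _ _) = All-swap₁₂ x y
  All-resp-≡K (knuth₂ x y _ _) = All-swap₂₃ x y
  All-resp-≡K K-refl           = λ p → p
  All-resp-≡K (K-sym e)        = All-resp-≡K⁻¹ e
  All-resp-≡K (K-trans e f)    = λ p → All-resp-≡K f (All-resp-≡K e p)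

  All-resp-≡K⁻¹ (knuth₁ x y _ _) = All-swap₁₂ x y
  All-resp-≡K⁻¹ (knuth₂ x y _ _) = All-swap₂₃ x y
  All-resp-≡K⁻¹ K-refl           = λ p → p
  All-resp-≡K⁻¹ (K-sym e)        = All-resp-≡K e
  All-resp-≡K⁻¹ (K-trans e f)    = λ p → All-resp-≡K⁻¹ e (All-resp-≡K⁻¹ f p)

RC-++ : ∀ m v w → RC m (v ++ w) ≡ RC m w ++ RC m v
RC-++ m v w = trans (cong reverse (map-++ _ v w)) (reverse-++ (map _ v) (map _ w))

RC-++-triple : ∀ m x y a b c →
  RC m (x ++ a ∷ b ∷ c ∷ y) ≡ RC m y ++ (suc m ∸ c) ∷ (suc m ∸ b) ∷ (suc m ∸ a) ∷ RC m x
RC-++-triple m x y a b c = trans (RC-++ m x (a ∷ b ∷ c ∷ y))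
  (trans (cong (_++ RC m x) (RC-++ m (a ∷ b ∷ c ∷ []) y)) (++-assoc (RC m y) _ (RC m x)))

-- The bound matters: with truncated subtraction, x ↦ m+1-x is strictly
-- order-reversing only for x ≤ m+1.
RC-resp-≡K : ∀ m {v w} → v ≡K w → All (_≤ m) v → RC m v ≡K RC m w
RC-resp-≡K m (knuth₁ x y {a} {b} {c} a≤b b<c) bounded with ++⁻ʳ x bounded
... | _ ∷ c≤m ∷ _ =
  subst₂ _≡K_ (sym (RC-++-triple m x y a c b)) (sym (RC-++-triple m x y c a b))
    (knuth₂ (RC m y) (RC m x) (∸-monoʳ-< b<c (m≤n⇒m≤1+n c≤m)) (∸-monoʳ-≤ (suc m) a≤b))
RC-resp-≡K m (knuth₂ x y {a} {b} {c} a<b b≤c) bounded with ++⁻ʳ x bounded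
... | b≤m ∷ _ =
  subst₂ _≡K_ (sym (RC-++-triple m x y b a c)) (sym (RC-++-triple m x y b c a))
    (knuth₁ (RC m y) (RC m x) (∸-monoʳ-≤ (suc m) b≤c) (∸-monoʳ-< a<b (m≤n⇒m≤1+n b≤m)))
RC-resp-≡K m K-refl        bounded = K-refl
RC-resp-≡K m (K-sym e)     bounded = K-sym (RC-resp-≡K m e (All-resp-≡K⁻¹ e bounded))
RC-resp-≡K m (K-trans e f) bounded =
  K-trans (RC-resp-≡K m e bounded) (RC-resp-≡K m f (All-resp-≡K e bounded))

≤ᵇ≡true⇒≤ : ∀ {m n} → (m ≤ᵇ n) ≡ true → m ≤ n
≤ᵇ≡true⇒≤ {m} {n} eq = ≤ᵇ⇒≤ m n (subst T (sym eq) _)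

≤ᵇ≡false⇒> : ∀ {m n} → (m ≤ᵇ n) ≡ false → n < m
≤ᵇ≡false⇒> eq = ≰⇒> (λ m≤n → subst T eq (≤⇒≤ᵇ m≤n))

Sorted : List ℕ → Set
Sorted = AllPairs _≤_

rowInsert-lowerBound : ∀ {lo} x r → All (lo ≤_) r → lo ≤ x → All (lo ≤_) (proj₂ (rowInsert x r))
rowInsert-lowerBound x []       []         lo≤x = lo≤x ∷ []
rowInsert-lowerBound x (y ∷ ys) (lo≤y ∷ ls) lo≤x with y ≤ᵇ x
... | false = lo≤x ∷ ls
... | true with rowInsert x ys | rowInsert-lowerBound x ys ls lo≤x
...   | _ , _ | ih = lo≤y ∷ ih

rowInsert-sorted : ∀ x r → Sorted r → Sorted (proj₂ (rowInsert x r))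
rowInsert-sorted x []       []          = [] ∷ []
rowInsert-sorted x (y ∷ ys) (y≤ys ∷ s) with y ≤ᵇ x in y≤ᵇx
... | false = All.map (≤-trans (<⇒≤ (≤ᵇ≡false⇒> y≤ᵇx))) y≤ys ∷ s
... | true with rowInsert x ys | rowInsert-lowerBound x ys y≤ys (≤ᵇ≡true⇒≤ y≤ᵇx)
                                | rowInsert-sorted x ys s
...   | _ , _ | y≤ys' | s' = y≤ys' ∷ s'

-- h ≤ x and x < z are what the inductive step of rowInsert-spec needs for its knuth₁ move.
data RowInsertion (x : ℕ) (r : List ℕ) : Bump × List ℕ → Set where
  appended : RowInsertion x r (none , r ++ [ x ])
  bumped   : ∀ {z h t} → h ≤ x → x < z → (r ++ [ x ]) ≡K (z ∷ h ∷ t) →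
             RowInsertion x r (some z , h ∷ t)

-- x moves left one letter at a time by knuth₂ (b x c ≡K b c x, as x < b ≤ c).
≡K-move-past-sorted : ∀ {x} b ys → x < b → All (b ≤_) ys → Sorted ys →
  (b ∷ ys ++ [ x ]) ≡K (b ∷ x ∷ ys)
≡K-move-past-sorted b []       x<b []         []          = K-refl
≡K-move-past-sorted b (c ∷ cs) x<b (b≤c ∷ _) (c≤cs ∷ s) =
  K-trans (≡K-++⁺ˡ [ b ] (≡K-move-past-sorted c cs (<-≤-trans x<b b≤c) c≤cs s))
          (K-sym (knuth₂ [] cs x<b b≤c))

rowInsert-spec : ∀ x r → Sorted r → RowInsertion x r (rowInsert x r)
rowInsert-spec x []       []          = appended
rowInsert-spec x (y ∷ ys) (y≤ys ∷ s) with y ≤ᵇ x in y≤ᵇx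
... | false = bumped ≤-refl x<y (≡K-move-past-sorted y ys x<y y≤ys s)
  where x<y = ≤ᵇ≡false⇒> y≤ᵇx
... | true with rowInsert x ys | rowInsert-spec x ys s
                                | rowInsert-lowerBound x ys y≤ys (≤ᵇ≡true⇒≤ y≤ᵇx)
...   | _ | appended              | _ = appended
...   | _ | bumped h≤x x<z ys≡K   | y≤h ∷ _ =
  bumped (≤ᵇ≡true⇒≤ y≤ᵇx) x<z (K-trans (≡K-++⁺ˡ [ y ] ys≡K) (knuth₁ [] _ y≤h (≤-<-trans h≤x x<z)))

rw-∷ : ∀ r rs → rw (r ∷ rs) ≡ rw rs ++ r
rw-∷ r rs = trans (cong concat (unfold-reverse r rs))
  (trans (sym (concat-++ (reverse rs) [ r ])) (cong (rw rs ++_) (++-identityʳ r)))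

rw-∷-++ : ∀ r rs x → rw (r ∷ rs) ++ [ x ] ≡ rw rs ++ (r ++ [ x ])
rw-∷-++ r rs x = trans (cong (_++ [ x ]) (rw-∷ r rs)) (++-assoc (rw rs) r [ x ])

insert-sorted : ∀ T x → All Sorted T → All Sorted (insert T x)
insert-sorted []       x _          = ([] ∷ []) ∷ []
insert-sorted (r ∷ rs) x (sr ∷ srs) with rowInsert x r | rowInsert-sorted x r sr
... | none   , _ | sr' = sr' ∷ srs
... | some z , _ | sr' = sr' ∷ insert-sorted rs z srs

rw-insert : ∀ T x → All Sorted T → rw (insert T x) ≡K (rw T ++ [ x ])
rw-insert []       x _          = K-refl
rw-insert (r ∷ rs) x (sr ∷ srs) with rowInsert x r | rowInsert-spec x r sr
... | _ | appended = ≡⇒≡K (trans (rw-∷ (r ++ [ x ]) rs) (sym (rw-∷-++ r rs x)))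
... | _ | bumped {z} {h} {t} _ _ r≡K = begin
  rw ((h ∷ t) ∷ insert rs z)   ≡⟨ rw-∷ (h ∷ t) (insert rs z) ⟩
  rw (insert rs z) ++ h ∷ t    ≈⟨ ≡K-++⁺ʳ (h ∷ t) (rw-insert rs z srs) ⟩
  (rw rs ++ [ z ]) ++ h ∷ t    ≡⟨ ++-assoc (rw rs) [ z ] (h ∷ t) ⟩
  rw rs ++ z ∷ h ∷ t           ≈⟨ ≡K-++⁺ˡ (rw rs) r≡K ⟨
  rw rs ++ (r ++ [ x ])        ≡⟨ rw-∷-++ r rs x ⟨
  rw (r ∷ rs) ++ [ x ]         ∎
  where open ≡K-Reasoning

rw-foldl-insert : ∀ T w → All Sorted T → rw (foldl insert T w) ≡K (rw T ++ w)
rw-foldl-insert T []      _ = ≡⇒≡K (sym (++-identityʳ (rw T)))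
rw-foldl-insert T (a ∷ w) s = begin
  rw (foldl insert (insert T a) w)   ≈⟨ rw-foldl-insert (insert T a) w (insert-sorted T a s) ⟩
  rw (insert T a) ++ w               ≈⟨ ≡K-++⁺ʳ w (rw-insert T a s) ⟩
  (rw T ++ [ a ]) ++ w               ≡⟨ ++-assoc (rw T) [ a ] w ⟩
  rw T ++ a ∷ w                      ∎
  where open ≡K-Reasoning

rw-P : ∀ w → rw (P w) ≡K w
rw-P w = rw-foldl-insert [] w []

RC-comm : ∀ m u w → All (_≤ m) (u ++ w) → (u ++ w) ≡K (w ++ u) →
  (RC m w ++ RC m u) ≡K (RC m u ++ RC m w)
RC-comm m u w bounded uw≡Kwu =
  subst₂ _≡K_ (RC-++ m u w) (RC-++ m w u) (RC-resp-≡K m uw≡Kwu bounded)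

lemma4p5 : (m : ℕ) → 1 ≤ m → (u w : Word) → InAlphabet m u → InAlphabet m w →
    (u ++ w) ≡K (w ++ u) →
    ((RC m w ++ RC m u) ≡K (RC m u ++ RC m w))
      × (∃[ v ] ((ε m (P w) ≡ P v) × ((v ++ RC m u) ≡K (RC m u ++ v))))
lemma4p5 m _ u w u∈[m]* w∈[m]* uw≡Kwu = RC-commutes , v , refl , v-commutes
  where
  open ≡K-Reasoning

  RC-commutes : (RC m w ++ RC m u) ≡K (RC m u ++ RC m w)
  RC-commutes = RC-comm m u w (++⁺ (All.map proj₂ u∈[m]*) (All.map proj₂ w∈[m]*)) uw≡Kwu

  v : Word
  v = RC m (rw (P w))

  v≡K : v ≡K RC m w
  v≡K = RC-resp-≡K m (rw-P w) (All-resp-≡K⁻¹ (rw-P w) (All.map proj₂ w∈[m]*))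

  v-commutes : (v ++ RC m u) ≡K (RC m u ++ v)
  v-commutes = begin
    v ++ RC m u        ≈⟨ ≡K-++⁺ʳ (RC m u) v≡K ⟩
    RC m w ++ RC m u   ≈⟨ RC-commutes ⟩
    RC m u ++ RC m w   ≈⟨ ≡K-++⁺ˡ (RC m u) v≡K ⟨
    RC m u ++ v        ∎
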